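{- Let $\mathcal{T}$ be a common suffix trie, let $p$ be a p-string, and suppose $\mathrm{spe}(p)$ is represented by a node $u$ of $\mathrm{PPH}(\mathcal{T})$. Then for every $1 \le i \le N_p$, $w_i$ has a prefix of length $|p|$ that p-matches $p$ if and only if $\mathrm{mrp}(i)$ is $u$ or a descendant of $u$.
   Context: $\Sigma$ and $\Pi$ are disjoint finite ordered alphabets; $\Sigma \cup \Pi$ carries a fixed total order and strings are compared lexicographically. A p-string is a string over $\Sigma \cup \Pi$; $w^R$ is the reversal of $w$. Two p-strings $x,y$ of equal length $k$ p-match iff some bijection $f$ on $\Sigma\cup\Pi$ fixing every element of $\Sigma$ satisfies $f(x[i]) = y[i]$ for all $i$. $\mathrm{spe}(x)$ is the lexicographically smallest p-string p-matching $x$. A common suffix trie (CS trie) is a rooted tree with edges directed towards the root, labeled by characters of $\Sigma\cup\Pi$, with mutually distinct labels on the in-coming edges of each node; each node represents the concatenation of labels on its path to the root. For a CS trie $\mathcal{T}$ with set $W_{\mathcal{T}}$ of represented p-strings, let $\mathrm{pcs}(\mathcal{T}) = \{\mathrm{spe}(w^R)^R : w \in W_{\mathcal{T}}\} = \{w_1,\ldots,w_{N_p}\}$ enumerated with $|w_i| \le |w_{i+1}|$. The sequence hash tree $\mathrm{SHT}(\langle s_1,\ldots,s_k\rangle)$ is the trie (nodes identified with the strings spelled from the root) built by starting from the root $\varepsilon$ and, for $i = 2, \ldots, k$, adding the node $u_i$ with edge $(v_i, s_i[|v_i|+1], u_i)$, where $v_i$ is the longest prefix of $s_i$ already a node and $u_i$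 the shortest prefix of $s_i$ not yet a node. $\mathrm{PPH}(\mathcal{T}) = \mathrm{SHT}(\langle \mathrm{spe}(w_1),\ldots,\mathrm{spe}(w_{N_p})\rangle)$. A p-string is represented by $\mathrm{PPH}(\mathcal{T})$ if some path from the root spells it. $\mathrm{mrp}(i)$ is the deepest node of $\mathrm{PPH}(\mathcal{T})$ that represents a prefix of $\mathrm{spe}(w_i)$. -}

module Defs where

open import Data.Nat using (ℕ; _≤_)
open import Data.Fin using (Fin)
open import Data.Fin.Properties using (_≟_)
import Data.Fin as F
open import Data.Bool using (Bool; true; false)
open import Data.List using (List; []; _∷_; _++_; length; reverse; map; inits; foldl; drop; lookup)
open import Data.List.Properties using (≡-dec)
open import Data.List.Membership.Propositional using (_∈_)
open import Data.List.Relation.Unary.Any using (any?)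
open import Data.List.Relation.Unary.Linked using (Linked)
open import Data.List.Relation.Unary.AllPairs using (AllPairs)
open import Data.Maybe using (Maybe; just; nothing)
open import Data.Product using (Σ; _×_; _,_; ∃; ∃-syntax)
open import Relation.Binary.PropositionalEquality using (_≡_; _≢_)
open import Relation.Nullary using (¬_; yes; no; Dec)
open import Function.Bundles using (_⤖_; Bijection)
open import Data.List.Relation.Binary.Lex.NonStrict using (Lex-≤)

-- Alphabet.  Σ ∪ Π is modelled as  Fin n  (the total order on Σ ∪ Π is
-- the order of Fin n); the predicate  isΣ  singles out the static
-- symbols Σ, the others form Π.  Σ and Π are therefore disjoint, finite,
-- and the order on Σ ∪ Π is an arbitrary total order.

Char : ℕ → Set
Char n = Fin n

PString : ℕ → Set
PString n = List (Char n)

FixesΣ : ∀ {n} → (Fin n → Bool) → (Fin n → Fin n) → Set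
FixesΣ isΣ f = ∀ c → isΣ c ≡ true → f c ≡ c

PMatch : ∀ {n} → (Fin n → Bool) → PString n → PString n → Set
PMatch isΣ x y =
  length x ≡ length y ×
  Σ (Fin _ ⤖ Fin _) λ f → FixesΣ isΣ (Bijection.to f) × map (Bijection.to f) x ≡ y

_≤lex_ : ∀ {n} → PString n → PString n → Set
_≤lex_ = Lex-≤ _≡_ F._≤_

IsSpe : ∀ {n} → (Fin n → Bool) → PString n → PString n → Set
IsSpe isΣ x s = PMatch isΣ x s × (∀ y → PMatch isΣ x y → s ≤lex y)

IsSpeFun : ∀ {n} → (Fin n → Bool) → (PString n → PString n) → Set
IsSpeFun isΣ spe = ∀ x → IsSpe isΣ x (spe x)

-- Common suffix tries.  A node carries the list of its in-coming edges
-- (label, child).  A child reached by an edge labelled a from a node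
-- representing v represents  a ∷ v.

data CSTrie (n : ℕ) : Set where
  node : List (Char n × CSTrie n) → CSTrie n

labels : ∀ {n} → List (Char n × CSTrie n) → List (Char n)
labels [] = []
labels ((a , _) ∷ es) = a ∷ labels es

data WellFormed {n : ℕ} : CSTrie n → Set
data AllWF {n : ℕ} : List (Char n × CSTrie n) → Set

data WellFormed {n} where
  wf : ∀ {es} → AllPairs _≢_ (labels es) → AllWF es → WellFormed (node es)

data AllWF {n} where
  []  : AllWF []
  _∷_ : ∀ {a t es} → WellFormed t → AllWF es → AllWF ((a , t) ∷ es)

data Path {n : ℕ} : CSTrie n → PString n → Set where
  here  : ∀ {t} → Path t []
  there : ∀ {es a t s} → (a , t) ∈ es → Path t s → Path (node es) (a ∷ s)

-- w ∈ W_T : w is represented by some node of T (the node-to-root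
-- concatenation of labels, i.e. the reverse of the root-to-node path)
Represents : ∀ {n} → CSTrie n → PString n → Set
Represents T w = Path T (reverse w)

-- pcs(T) enumerated as  w₁ … w_{N_p}:  a duplicate-free list whose
-- elements are exactly the elements of pcs(T), with |wᵢ| ≤ |wᵢ₊₁|.

IsPcsEnum : ∀ {n} → (Fin n → Bool) → (PString n → PString n) →
            CSTrie n → List (PString n) → Set
IsPcsEnum isΣ spe T ws =
  AllPairs _≢_ ws ×
  (∀ x → (x ∈ ws → ∃[ w ] (Represents T w × x ≡ reverse (spe (reverse w)))) ×
         (∀ w → Represents T w → reverse (spe (reverse w)) ∈ ws)) ×
  Linked (λ x y → length x ≤ length y) ws

-- Nodes are identified with the strings spelled from
-- the root; the node set is prefix-closed, and the parent of a node u ∷ʳ a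
-- is u (so the edge (vᵢ, sᵢ[|vᵢ|+1], uᵢ) is determined by uᵢ).

Prefix : ∀ {n} → PString n → PString n → Set
Prefix u s = ∃[ t ] (u ++ t ≡ s)

mem? : ∀ {n} (x : PString n) (xs : List (PString n)) → Dec (x ∈ xs)
mem? x xs = any? (λ y → ≡-dec _≟_ x y) xs

firstNew : ∀ {n} → List (PString n) → List (PString n) → Maybe (PString n)
firstNew nodes [] = nothing
firstNew nodes (u ∷ us) with mem? u nodes
... | yes _ = firstNew nodes us
... | no _  = just u

shtStep : ∀ {n} → List (PString n) → PString n → List (PString n)
shtStep nodes s with firstNew nodes (inits s)
... | nothing = nodes
... | just u  = nodes ++ (u ∷ [])

-- node set of SHT(⟨s₁,…,s_k⟩): start from the root ε, process s₂,…,s_k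
SHTNodes : ∀ {n} → List (PString n) → List (PString n)
SHTNodes [] = [] ∷ []
SHTNodes (_ ∷ ss) = foldl shtStep ([] ∷ []) ss

PPHNodes : ∀ {n} → (PString n → PString n) → List (PString n) → List (PString n)
PPHNodes spe ws = SHTNodes (map spe ws)

IsDeepestPrefixNode : ∀ {n} → List (PString n) → PString n → PString n → Set
IsDeepestPrefixNode nodes s m =
  m ∈ nodes × Prefix m s × (∀ m′ → m′ ∈ nodes → Prefix m′ s → length m′ ≤ length m)

IsMrp : ∀ {n} → (PString n → PString n) → (ws : List (PString n)) → Fin (length ws) → PString n → Set
IsMrp spe ws i m = IsDeepestPrefixNode (PPHNodes spe ws) (spe (lookup ws i)) m

UOrDescendant : ∀ {n} → PString n → PString n → Set
UOrDescendant u m = Prefix u m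

-- The normal form spe is prefix-stable: the Σ-fixing bijection that sends w to spe(w) also sends
-- every prefix q of w to spe(q), because any smaller image of q would extend to a smaller image
-- of w.  Hence q ↦ spe(q) maps the length-|p| prefixes of wᵢ that p-match p exactly to the
-- occurrences of spe(p) = u as a prefix of spe(wᵢ).  Since u is a node of PPH(T) and mrp(i) is
-- the deepest node that is a prefix of spe(wᵢ), u is such a prefix iff it is a prefix of mrp(i).
-- Neither the shape of T nor the order of the enumeration plays any role.
module Submission where

open import Defs
open import Data.Nat using (ℕ; pred; _≤_; s≤s)
open import Data.Fin using (Fin)
open import Data.Fin.Properties using (≤-antisym)
open import Data.Bool using (Bool)
open import Data.List using (List; []; _∷_; _++_; length; lookup; map; take; drop)
open import Data.List.Properties
  using (∷-injective; ++-assoc; length-map; map-++; map-∘; map-cong; map-id; take-map; take++drop≡id)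
open import Data.List.Membership.Propositional using (_∈_)
open import Data.List.Relation.Binary.Lex.Core using (base; this; next)
open import Data.List.Relation.Binary.Lex.NonStrict using (≤-antisymmetric)
open import Data.List.Relation.Binary.Pointwise using (Pointwise-≡⇒≡)
open import Data.Product using (_×_; ∃-syntax; _,_; proj₁; proj₂)
open import Data.Unit using (tt)
open import Function.Bundles using (_⇔_; mk⇔; _⤖_; Bijection)
open import Function.Construct.Composition using (_⤖-∘_)
open import Function.Construct.Symmetry using (⤖-sym)
open import Relation.Binary.PropositionalEquality
  using (_≡_; refl; sym; trans; cong; subst; subst₂; module ≡-Reasoning)

private
  variable
    n : ℕ

open Bijection using (to)

Prefix-trans : {a b c : PString n} → Prefix a b → Prefix b c → Prefix a c
Prefix-trans {a = a} (s , refl) (t , refl) = s ++ t , sym (++-assoc a s t)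

Prefix-of-common-≤ : {a b s : PString n} → Prefix a s → Prefix b s →
                     length a ≤ length b → Prefix a b
Prefix-of-common-≤ {a = []}    {b}     _ _ _ = b , refl
Prefix-of-common-≤ {a = x ∷ a} {y ∷ b} (t , refl) (t′ , eq) (s≤s a≤b)
  with refl , eq′ ← ∷-injective eq
  with c , refl ← Prefix-of-common-≤ (t , refl) (t′ , eq′) a≤b = c , refl

take-Prefix : {a s : PString n} → Prefix a s → take (length a) s ≡ a
take-Prefix {a = []}    _          = refl
take-Prefix {a = x ∷ a} (t , refl) = cong (x ∷_) (take-Prefix (t , refl))

≤lex-antisym : {a b : PString n} → a ≤lex b → b ≤lex a → a ≡ b
≤lex-antisym a≤b b≤a = Pointwise-≡⇒≡ (≤-antisymmetric sym ≤-antisym a≤b b≤a)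

≤lex-++-cancelʳ : (a b : PString n) {r s : PString n} → length a ≡ length b →
                  (a ++ r) ≤lex (b ++ s) → a ≤lex b
≤lex-++-cancelʳ []      []      _  _               = base tt
≤lex-++-cancelʳ (x ∷ a) (y ∷ b) _  (this x<y)      = this x<y
≤lex-++-cancelʳ (x ∷ a) (y ∷ b) eq (next x≡y a≤b) =
  next x≡y (≤lex-++-cancelʳ a b (cong pred eq) a≤b)

module _ (isΣ : Fin n → Bool) where

  PMatch-map : (f : Fin n ⤖ Fin n) → FixesΣ isΣ (to f) → (x : PString n) →
               PMatch isΣ x (map (to f) x)
  PMatch-map f fixes x = sym (length-map (to f) x) , f , fixes , refl

  PMatch-sym : {x y : PString n} → PMatch isΣ x y → PMatch isΣ y x
  PMatch-sym {x} {y} (len , f , fixes , refl) = sym len , f⁻¹ , fixes⁻¹ , map-inverse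
    where
    f⁻¹ = ⤖-sym f
    inverseˡ : ∀ c → to f⁻¹ (to f c) ≡ c
    inverseˡ c = Bijection.injective f (proj₂ (Bijection.strictlySurjective f (to f c)))
    fixes⁻¹ : FixesΣ isΣ (to f⁻¹)
    fixes⁻¹ c c∈Σ = trans (cong (to f⁻¹) (sym (fixes c c∈Σ))) (inverseˡ c)
    map-inverse : map (to f⁻¹) (map (to f) x) ≡ x
    map-inverse = trans (sym (map-∘ x)) (trans (map-cong inverseˡ x) (map-id x))

  PMatch-trans : {x y z : PString n} → PMatch isΣ x y → PMatch isΣ y z → PMatch isΣ x z
  PMatch-trans {x} (len , f , f-fixes , refl) (len′ , g , g-fixes , refl) =
    trans len len′ , g ⤖-∘ f ,
    (λ c c∈Σ → trans (cong (to g) (f-fixes c c∈Σ)) (g-fixes c c∈Σ)) ,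
    map-∘ x

module _ (isΣ : Fin n → Bool) (spe : PString n → PString n) (isSpe : IsSpeFun isΣ spe) where

  PMatch-spe : (x : PString n) → PMatch isΣ x (spe x)
  PMatch-spe x = proj₁ (isSpe x)

  spe-minimal : (x y : PString n) → PMatch isΣ x y → spe x ≤lex y
  spe-minimal x = proj₂ (isSpe x)

  normaliser : PString n → Fin n ⤖ Fin n
  normaliser x = proj₁ (proj₂ (PMatch-spe x))

  normaliser-fixesΣ : (x : PString n) → FixesΣ isΣ (to (normaliser x))
  normaliser-fixesΣ x = proj₁ (proj₂ (proj₂ (PMatch-spe x)))

  map-normaliser : (x : PString n) → map (to (normaliser x)) x ≡ spe x
  map-normaliser x = proj₂ (proj₂ (proj₂ (PMatch-spe x)))

  length-spe : (x : PString n) → length (spe x) ≡ length x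
  length-spe x = sym (proj₁ (PMatch-spe x))

  spe-cong : {x y : PString n} → PMatch isΣ x y → spe x ≡ spe y
  spe-cong {x} {y} x≈y = ≤lex-antisym
    (spe-minimal x (spe y) (PMatch-trans isΣ x≈y (PMatch-spe y)))
    (spe-minimal y (spe x) (PMatch-trans isΣ (PMatch-sym isΣ x≈y) (PMatch-spe x)))

  map-normaliser-prefix : (q t : PString n) → map (to (normaliser (q ++ t))) q ≡ spe q
  map-normaliser-prefix q t = ≤lex-antisym Fq≤spe-q spe-q≤Fq
    where
    F = to (normaliser (q ++ t))
    G = to (normaliser q)
    spe-qt≤Gqt : (map F q ++ map F t) ≤lex (spe q ++ map G t)
    spe-qt≤Gqt = subst₂ _≤lex_
      (trans (sym (map-normaliser (q ++ t))) (map-++ F q t))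
      (trans (map-++ G q t) (cong (_++ map G t) (map-normaliser q)))
      (spe-minimal (q ++ t) _ (PMatch-map isΣ (normaliser q) (normaliser-fixesΣ q) (q ++ t)))
    Fq≤spe-q : map F q ≤lex spe q
    Fq≤spe-q = ≤lex-++-cancelʳ (map F q) (spe q)
      (trans (length-map F q) (sym (length-spe q))) spe-qt≤Gqt
    spe-q≤Fq : spe q ≤lex map F q
    spe-q≤Fq = spe-minimal q _
      (PMatch-map isΣ (normaliser (q ++ t)) (normaliser-fixesΣ (q ++ t)) q)

  spe-mono-Prefix : {q w : PString n} → Prefix q w → Prefix (spe q) (spe w)
  spe-mono-Prefix {q} (t , refl) = map F t , (begin
    spe q ++ map F t       ≡⟨ cong (_++ map F t) (map-normaliser-prefix q t) ⟨
    map F q ++ map F t     ≡⟨ map-++ F q t ⟨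
    map F (q ++ t)         ≡⟨ map-normaliser (q ++ t) ⟩
    spe (q ++ t)           ∎)
    where
    open ≡-Reasoning
    F = to (normaliser (q ++ t))

  PMatch-take-spe : {p w : PString n} → Prefix (spe p) (spe w) →
                    PMatch isΣ (take (length p) w) p
  PMatch-take-spe {p} {w} spe-p≼spe-w =
    PMatch-trans isΣ q≈spe-p (PMatch-sym isΣ (PMatch-spe p))
    where
    open ≡-Reasoning
    k = length p
    F = to (normaliser w)
    Fq≡spe-p : map F (take k w) ≡ spe p
    Fq≡spe-p = begin
      map F (take k w)              ≡⟨ take-map k w ⟨
      take k (map F w)              ≡⟨ cong (take k) (map-normaliser w) ⟩
      take k (spe w)                ≡⟨ cong (λ j → take j (spe w)) (length-spe p) ⟨
      take (length (spe p)) (spe w) ≡⟨ take-Prefix spe-p≼spe-w ⟩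
      spe p                         ∎
    q≈spe-p : PMatch isΣ (take k w) (spe p)
    q≈spe-p = subst (PMatch isΣ (take k w)) Fq≡spe-p
      (PMatch-map isΣ (normaliser w) (normaliser-fixesΣ w) (take k w))

lemma2 : ∀ {n : ℕ} (isΣ : Fin n → Bool) (spe : PString n → PString n) →
    IsSpeFun isΣ spe →
    (T : CSTrie n) → WellFormed T →
    (ws : List (PString n)) → IsPcsEnum isΣ spe T ws →
    (p u : PString n) → u ∈ PPHNodes spe ws → u ≡ spe p →
    (i : Fin (length ws)) (m : PString n) → IsMrp spe ws i m →
    (∃[ q ] (Prefix q (lookup ws i) × length q ≡ length p × PMatch isΣ q p))
    ⇔ UOrDescendant u m
lemma2 isΣ spe isSpe _ _ ws _ p u u∈nodes refl i m (_ , m≼spe-w , deepest) =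
  mk⇔ occurrence⇒descendant descendant⇒occurrence
  where
  w = lookup ws i
  occurrence⇒descendant : ∃[ q ] (Prefix q w × length q ≡ length p × PMatch isΣ q p) →
                          Prefix u m
  occurrence⇒descendant (q , q≼w , _ , q≈p) =
    Prefix-of-common-≤ u≼spe-w m≼spe-w (deepest u u∈nodes u≼spe-w)
    where
    u≼spe-w : Prefix (spe p) (spe w)
    u≼spe-w = subst₂ Prefix (spe-cong isΣ spe isSpe q≈p) refl (spe-mono-Prefix isΣ spe isSpe q≼w)
  descendant⇒occurrence : Prefix u m →
                          ∃[ q ] (Prefix q w × length q ≡ length p × PMatch isΣ q p)
  descendant⇒occurrence u≼m =
    take (length p) w , (drop (length p) w , take++drop≡id (length p) w) ,
    proj₁ q≈p , q≈p
    where
    q≈p = PMatch-take-spe isΣ spe isSpe (Prefix-trans u≼m m≼spe-w)
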